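{- Let $p,q\ge1$ be integers. Every weak $(p,q)$-quasi-shuffle $\varphi:\{1,\ldots,p+q\}\to\{1,\ldots,s\}$ admits a unique decomposition $\varphi=\delta\circ\sigma$ where (a) $\sigma:\{1,\ldots,p+q\}\to\{1,\ldots,t\}$ is a nondecreasing surjection for some $t$ with $2\le t\le p+q$, such that $\sigma_p<\sigma_{p+1}$, and (b) $\delta:\{1,\ldots,t\}\to\{1,\ldots,s\}$ is a $(\sigma_p,t-\sigma_p)$-quasi-shuffle of type $t-s$.
   Context: For integers $a,b\ge1$ and $r\ge0$, an $(a,b)$-quasi-shuffle of type $r$ is a surjective map $\sigma:\{1,\ldots,a+b\}\to\{1,\ldots,a+b-r\}$ with $\sigma_1<\cdots<\sigma_a$ and $\sigma_{a+1}<\cdots<\sigma_{a+b}$. A weak $(p,q)$-quasi-shuffle of type $r$ is a surjective map $\varphi:\{1,\ldots,p+q\}\to\{1,\ldots,p+q-r\}$ with $\varphi_1\le\cdots\le\varphi_p$ and $\varphi_{p+1}\le\cdots\le\varphi_{p+q}$. We write $\sigma_i$ for $\sigma(i)$. -}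

module Defs where

open import Data.Nat using (ℕ; suc; _+_; _∸_; _≤_; _<_)
open import Data.Fin using (Fin; toℕ)
open import Data.Product using (Σ; ∃; _×_)
open import Relation.Binary.PropositionalEquality using (_≡_)

-- Convention: {1,…,n} is modelled by Fin n, with position k (1-based)
-- represented by the Fin element of value k-1.  Comparisons of values
-- are made through toℕ.

Surj : ∀ {n m} → (Fin n → Fin m) → Set
Surj {n} f = ∀ y → ∃ λ (x : Fin n) → f x ≡ y

StrictOnBlocks : ∀ {n m} → ℕ → (Fin n → Fin m) → Set
StrictOnBlocks {n} a f =
  (∀ (i j : Fin n) → toℕ i < toℕ j → toℕ j < a → toℕ (f i) < toℕ (f j)) ×
  (∀ (i j : Fin n) → a ≤ toℕ i → toℕ i < toℕ j → toℕ (f i) < toℕ (f j))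

WeakOnBlocks : ∀ {n m} → ℕ → (Fin n → Fin m) → Set
WeakOnBlocks {n} a f =
  (∀ (i j : Fin n) → toℕ i < toℕ j → toℕ j < a → toℕ (f i) ≤ toℕ (f j)) ×
  (∀ (i j : Fin n) → a ≤ toℕ i → toℕ i < toℕ j → toℕ (f i) ≤ toℕ (f j))

IsQuasiShuffle : ℕ → ℕ → ℕ → ∀ {n m} → (Fin n → Fin m) → Set
IsQuasiShuffle a b r {n} {m} f =
  (1 ≤ a) × (1 ≤ b) × (n ≡ a + b) × (m + r ≡ a + b) × Surj f × StrictOnBlocks a f

IsWeakQuasiShuffle : (p q r : ℕ) → ∀ {m} → (Fin (p + q) → Fin m) → Set
IsWeakQuasiShuffle p q r {m} φ =
  (m + r ≡ p + q) × Surj φ × WeakOnBlocks p φ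

Nondecreasing : ∀ {n m} → (Fin n → Fin m) → Set
Nondecreasing {n} f = ∀ (i j : Fin n) → toℕ i ≤ toℕ j → toℕ (f i) ≤ toℕ (f j)

-- A decomposition φ = δ ∘ σ as in Lemma 4.1 (a),(b).
-- The index i with suc (toℕ i) ≡ p is position p; j with toℕ j ≡ p is position p+1.
-- The 1-based value σ_p is suc (toℕ (σ i)).
record Decomposition (p q s : ℕ) (φ : Fin (p + q) → Fin s) : Set where
  field
    t      : ℕ
    σ      : Fin (p + q) → Fin t
    δ      : Fin t → Fin s
    2≤t    : 2 ≤ t
    t≤p+q  : t ≤ p + q
    σ-mono : Nondecreasing σ
    σ-surj : Surj σ
    σ-jump : ∀ (i j : Fin (p + q)) → suc (toℕ i) ≡ p → toℕ j ≡ p →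
             toℕ (σ i) < toℕ (σ j)
    δ-qs   : ∀ (i : Fin (p + q)) → suc (toℕ i) ≡ p →
             IsQuasiShuffle (suc (toℕ (σ i))) (t ∸ suc (toℕ (σ i))) (t ∸ s) δ
    factor : ∀ (k : Fin (p + q)) → φ k ≡ δ (σ k)

open Decomposition public

SameDecomposition : ∀ {p q s φ} → Decomposition p q s φ → Decomposition p q s φ → Set
SameDecomposition {p} {q} D E =
  (t D ≡ t E) ×
  (∀ (k : Fin (p + q)) → toℕ (σ D k) ≡ toℕ (σ E k)) ×
  (∀ (x : Fin (t D)) (y : Fin (t E)) → toℕ x ≡ toℕ y → toℕ (δ D x) ≡ toℕ (δ E y))

-- A nondecreasing surjection σ from positions onto {1, …, t} is determined by the set of
-- positions m with σ_m < σ_{m+1}, being the function counting these ascents.  In a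
-- decomposition φ = δ ∘ σ, σ must ascend at m = p, and wherever φ_m ≠ φ_{m+1}; it cannot
-- ascend anywhere else, since inside a block δ is strictly increasing, so an ascent of σ with
-- φ_m = φ_{m+1} is impossible.  This forces σ, hence t and δ (σ is onto), which is uniqueness.
-- Conversely, the counting function σ works: φ is constant between consecutive ascents, so
-- δ (σ k) := φ k is well defined, and δ is strict on its blocks because φ is weakly increasing
-- on its blocks and changes value at every ascent other than p.
module Submission where

open import Defs
open import Level using (0ℓ)
open import Function using (_∘_)
open import Data.Nat using (ℕ; zero; suc; _+_; _∸_; _≤_; _<_; z≤n; s≤s; _≟_; _<?_; _≤?_)
open import Data.Nat.Properties
open import Data.Fin as F using (Fin; toℕ; fromℕ<; fromℕ)
open import Data.Fin.Properties
  using (toℕ-injective; toℕ<n; toℕ≤pred[n]; fromℕ<-toℕ; toℕ-fromℕ<; toℕ-fromℕ; injective⇒≤)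
open import Data.Product using (Σ; ∃; _×_; _,_; proj₁; proj₂)
open import Data.Sum using (_⊎_; inj₁; inj₂)
open import Data.Empty using (⊥; ⊥-elim)
open import Relation.Binary using (tri<; tri≈; tri>)
open import Relation.Binary.PropositionalEquality
open import Relation.Nullary using (¬_; Dec; yes; no; contradiction)
open import Relation.Nullary.Decidable using (¬?; _⊎-dec_; decidable-stable)
open import Relation.Unary using (Pred; Decidable)

extend : ∀ {n m} → (Fin n → Fin m) → ℕ → ℕ
extend {n} f k with k <? n
... | yes k<n = toℕ (f (fromℕ< k<n))
... | no _    = 0

extend-fromℕ< : ∀ {n m} (f : Fin n → Fin m) {k} (k<n : k < n) →
                extend f k ≡ toℕ (f (fromℕ< k<n))
extend-fromℕ< {n} f {k} k<n with k <? n
... | yes _   = refl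
... | no k≮n = contradiction k<n k≮n

extend-toℕ : ∀ {n m} (f : Fin n → Fin m) (i : Fin n) → extend f (toℕ i) ≡ toℕ (f i)
extend-toℕ f i = trans (extend-fromℕ< f (toℕ<n i)) (cong (λ j → toℕ (f j)) (fromℕ<-toℕ i (toℕ<n i)))

extend-mono-on : ∀ {n m} (f : Fin n → Fin m) {lo hi} → hi ≤ n →
                 (∀ (i j : Fin n) → lo ≤ toℕ i → toℕ i < toℕ j → toℕ j < hi → toℕ (f i) ≤ toℕ (f j)) →
                 ∀ {k l} → lo ≤ k → k ≤ l → l < hi → extend f k ≤ extend f l
extend-mono-on f {lo} hi≤n mono {k} {l} lo≤k k≤l l<hi with m≤n⇒m<n∨m≡n k≤l
... | inj₂ refl = ≤-refl
... | inj₁ k<l  = subst₂ _≤_ (sym (extend-fromℕ< f k<n)) (sym (extend-fromℕ< f l<n))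
                    (mono (fromℕ< k<n) (fromℕ< l<n)
                      (subst (lo ≤_) (sym (toℕ-fromℕ< k<n)) lo≤k)
                      (subst₂ _<_ (sym (toℕ-fromℕ< k<n)) (sym (toℕ-fromℕ< l<n)) k<l)
                      (subst (_< _) (sym (toℕ-fromℕ< l<n)) l<hi))
  where
  l<n : l < _
  l<n = <-≤-trans l<hi hi≤n
  k<n : k < _
  k<n = <-trans k<l l<n

surj⇒≤ : ∀ {m n} {f : Fin m → Fin n} → Surj f → n ≤ m
surj⇒≤ {f = f} surj = injective⇒≤ {f = λ y → proj₁ (surj y)}
  (λ {x} {y} e → trans (sym (proj₂ (surj x))) (trans (cong f e) (proj₂ (surj y))))

quasiShuffle-strict : ∀ {a b r n m} {f : Fin n → Fin m} → IsQuasiShuffle a b r f → StrictOnBlocks a f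
quasiShuffle-strict (_ , _ , _ , _ , _ , strict) = strict

nondecreasing-surj-zero : ∀ {n t} {σ : Fin n → Fin t} → Nondecreasing σ → Surj σ →
                          ∀ i → toℕ i ≡ 0 → toℕ (σ i) ≡ 0
nondecreasing-surj-zero {t = zero}  {σ} _ _ i _ with σ i
... | ()
nondecreasing-surj-zero {t = suc _} {σ} mono surj i i≡0 =
  n≤0⇒n≡0 (subst (toℕ (σ i) ≤_) (cong toℕ (proj₂ (surj F.zero)))
    (mono i (proj₁ (surj F.zero)) (subst (_≤ _) (sym i≡0) z≤n)))

-- The value right after σ i is attained somewhere, and monotonicity leaves no room for it before j.
nondecreasing-surj-step : ∀ {n t} {σ : Fin n → Fin t} → Nondecreasing σ → Surj σ →
                          ∀ i j → toℕ j ≡ suc (toℕ i) → toℕ (σ j) ≤ suc (toℕ (σ i))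
nondecreasing-surj-step {σ = σ} mono surj i j j≡1+i with toℕ (σ j) ≤? suc (toℕ (σ i))
... | yes σj≤1+σi = σj≤1+σi
... | no σj≰1+σi  = ⊥-elim (placed (toℕ x ≤? toℕ i))
  where
  v<t : suc (toℕ (σ i)) < _
  v<t = <-trans (≰⇒> σj≰1+σi) (toℕ<n (σ j))
  x = proj₁ (surj (fromℕ< v<t))
  σx≡1+σi : toℕ (σ x) ≡ suc (toℕ (σ i))
  σx≡1+σi = trans (cong toℕ (proj₂ (surj (fromℕ< v<t)))) (toℕ-fromℕ< v<t)
  placed : Dec (toℕ x ≤ toℕ i) → ⊥
  placed (yes x≤i) = n≮n _ (subst (_≤ _) σx≡1+σi (mono x i x≤i))
  placed (no x≰i)  = σj≰1+σi (subst (_ ≤_) σx≡1+σi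
                       (mono j x (subst (_≤ toℕ x) (sym j≡1+i) (≰⇒> x≰i))))

nondecreasing-surj-last : ∀ {N t} {σ : Fin (suc N) → Fin t} → Nondecreasing σ → Surj σ →
                          suc (toℕ (σ (fromℕ N))) ≡ t
nondecreasing-surj-last {t = zero}  {σ} _ _ with σ F.zero
... | ()
nondecreasing-surj-last {N} {suc t} {σ} mono surj = ≤-antisym (toℕ<n (σ (fromℕ N))) (s≤s t≤σlast)
  where
  x = proj₁ (surj (fromℕ t))
  t≤σlast : t ≤ toℕ (σ (fromℕ N))
  t≤σlast = subst (_≤ _) (trans (cong toℕ (proj₂ (surj (fromℕ t)))) (toℕ-fromℕ t))
              (mono x (fromℕ N) (subst (toℕ x ≤_) (sym (toℕ-fromℕ N)) (toℕ≤pred[n] x)))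

module Rank {Ascent : Pred ℕ 0ℓ} (ascent? : Decidable Ascent) where

  rank : ℕ → ℕ
  rank zero = zero
  rank (suc m) with ascent? m
  ... | yes _ = suc (rank m)
  ... | no _  = rank m

  rank-ascent : ∀ {m} → Ascent m → rank (suc m) ≡ suc (rank m)
  rank-ascent {m} a with ascent? m
  ... | yes _ = refl
  ... | no ¬a = contradiction a ¬a

  rank-flat : ∀ {m} → ¬ Ascent m → rank (suc m) ≡ rank m
  rank-flat {m} ¬a with ascent? m
  ... | yes a = contradiction a ¬a
  ... | no _  = refl

  rank-≤ : ∀ k → rank k ≤ k
  rank-≤ zero = z≤n
  rank-≤ (suc k) with ascent? k
  ... | yes _ = s≤s (rank-≤ k)
  ... | no _  = m≤n⇒m≤1+n (rank-≤ k)

  rank-≤-suc : ∀ k → rank k ≤ rank (suc k)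
  rank-≤-suc k with ascent? k
  ... | yes _ = n≤1+n _
  ... | no _  = ≤-refl

  rank-mono : ∀ {k l} → k ≤ l → rank k ≤ rank l
  rank-mono {l = zero} z≤n = ≤-refl
  rank-mono {k} {suc l} k≤1+l with m≤n⇒m<n∨m≡n k≤1+l
  ... | inj₂ refl      = ≤-refl
  ... | inj₁ (s≤s k≤l) = ≤-trans (rank-mono k≤l) (rank-≤-suc l)

  ascent-separates : ∀ {k m} → Ascent m → rank k ≤ rank m → k ≤ m
  ascent-separates {k} {m} a rk≤rm with k ≤? m
  ... | yes k≤m = k≤m
  ... | no k≰m  = contradiction (≤-trans (subst (_≤ rank k) (rank-ascent a) (rank-mono (≰⇒> k≰m))) rk≤rm)
                                (n≮n (rank m))

  rank-surj : ∀ l {y} → y ≤ rank l → ∃ λ k → k ≤ l × rank k ≡ y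
  rank-surj zero y≤0 = zero , z≤n , sym (n≤0⇒n≡0 y≤0)
  rank-surj (suc l) {y} y≤rank with ascent? l | y ≤? rank l
  ... | _     | yes y≤r = let k , k≤l , e = rank-surj l y≤r in k , m≤n⇒m≤1+n k≤l , e
  ... | yes a | no y≰r  = suc l , ≤-refl , trans (rank-ascent a) (≤-antisym (≰⇒> y≰r) y≤rank)
  ... | no _  | no y≰r  = contradiction y≤rank y≰r

  rank-<⇒ascent : ∀ {k l} → rank k < rank l → ∃ λ m → k ≤ m × m < l × Ascent m
  rank-<⇒ascent {k} {suc l} rk<rl with ascent? l
  ... | yes a = l , ascent-separates a (≤-pred rk<rl) , ≤-refl , a
  ... | no _  = let m , k≤m , m<l , a = rank-<⇒ascent rk<rl in m , k≤m , m≤n⇒m≤1+n m<l , a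

  module _ {B : Set} (g : ℕ → B) (flat : ∀ m → ¬ Ascent m → g m ≡ g (suc m)) where

    private
      upward : ∀ {k l} → k ≤ l → rank k ≡ rank l → g k ≡ g l
      upward {l = zero} z≤n _ = refl
      upward {k} {suc l} k≤1+l e with m≤n⇒m<n∨m≡n k≤1+l
      ... | inj₂ refl = refl
      ... | inj₁ (s≤s k≤l) with ascent? l
      ...   | yes _ = contradiction (≤-trans (≤-reflexive (sym e)) (rank-mono k≤l)) (n≮n (rank l))
      ...   | no ¬a = trans (upward k≤l e) (flat l ¬a)

    rank-fibres-constant : ∀ {k l} → rank k ≡ rank l → g k ≡ g l
    rank-fibres-constant {k} {l} e with ≤-total k l
    ... | inj₁ k≤l = upward k≤l e
    ... | inj₂ l≤k = sym (upward l≤k (sym e))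

  rank-unique : ∀ {n t} (σ : Fin n → Fin t) →
                (∀ i → toℕ i ≡ 0 → toℕ (σ i) ≡ 0) →
                (∀ i j → toℕ j ≡ suc (toℕ i) → Ascent (toℕ i) → toℕ (σ j) ≡ suc (toℕ (σ i))) →
                (∀ i j → toℕ j ≡ suc (toℕ i) → ¬ Ascent (toℕ i) → toℕ (σ j) ≡ toℕ (σ i)) →
                ∀ i → toℕ (σ i) ≡ rank (toℕ i)
  rank-unique {n} σ base up flat x =
    trans (cong (λ y → toℕ (σ y)) (sym (fromℕ<-toℕ x (toℕ<n x)))) (at (toℕ x) (toℕ<n x))
    where
    at : ∀ k (k<n : k < n) → toℕ (σ (fromℕ< k<n)) ≡ rank k
    at zero    k<n = base _ (toℕ-fromℕ< k<n)
    at (suc k) 1+k<n = step (ascent? k)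
      where
      k<n = <⇒≤ 1+k<n
      i = fromℕ< k<n
      j = fromℕ< 1+k<n
      i≡k : toℕ i ≡ k
      i≡k = toℕ-fromℕ< k<n
      adjacent : toℕ j ≡ suc (toℕ i)
      adjacent = trans (toℕ-fromℕ< 1+k<n) (cong suc (sym i≡k))
      step : Dec (Ascent k) → toℕ (σ j) ≡ rank (suc k)
      step (yes a) = trans (up i j adjacent (subst Ascent (sym i≡k) a))
                           (trans (cong suc (at k k<n)) (sym (rank-ascent a)))
      step (no ¬a) = trans (flat i j adjacent (¬a ∘ subst Ascent i≡k))
                           (trans (at k k<n) (sym (rank-flat ¬a)))

module Decompose (p′ q′ : ℕ) {s} (φ : Fin (suc p′ + suc q′) → Fin s)
                 (φ-surj : Surj φ) (φ-weak : WeakOnBlocks (suc p′) φ) where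

  -- Positions are 0-based: p′ is position p, the last of the first block, and N the last one.
  N : ℕ
  N = p′ + suc q′

  p′<N : p′ < N
  p′<N = subst (suc p′ ≤_) (sym (+-suc p′ q′)) (s≤s (m≤m+n p′ q′))

  f : ℕ → ℕ
  f = extend φ

  Ascent : Pred ℕ 0ℓ
  Ascent m = m ≡ p′ ⊎ f m ≢ f (suc m)

  ascent? : Decidable Ascent
  ascent? m = (m ≟ p′) ⊎-dec ¬? (f m ≟ f (suc m))

  open Rank ascent?

  f-flat : ∀ m → ¬ Ascent m → f m ≡ f (suc m)
  f-flat m ¬a = decidable-stable (f m ≟ f (suc m)) (¬a ∘ inj₂)

  f-mono₁ : ∀ {k l} → k ≤ l → l ≤ p′ → f k ≤ f l
  f-mono₁ k≤l l≤p′ = extend-mono-on φ (s≤s (<⇒≤ p′<N)) (λ i j _ → proj₁ φ-weak i j) z≤n k≤l (s≤s l≤p′)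

  f-mono₂ : ∀ {k l} → suc p′ ≤ k → k ≤ l → l ≤ N → f k ≤ f l
  f-mono₂ p<k k≤l l≤N = extend-mono-on φ ≤-refl (λ i j p<i i<j _ → proj₂ φ-weak i j p<i i<j) p<k k≤l (s≤s l≤N)

  rank-<⇒f-< : ∀ {k l} → rank k < rank l → l ≤ p′ ⊎ suc p′ ≤ k → l ≤ N → f k < f l
  rank-<⇒f-< {k} {l} rk<rl side l≤N with rank-<⇒ascent {k} {l} rk<rl
  ... | m , k≤m , m<l , a with side | a
  ... | inj₁ l≤p′ | inj₁ refl = contradiction (≤-trans m<l l≤p′) (n≮n m)
  ... | inj₂ p<k  | inj₁ refl = contradiction (≤-trans p<k k≤m) (n≮n m)
  ... | inj₁ l≤p′ | inj₂ fm≢fm+1 = begin-strict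
    f k       ≤⟨ f-mono₁ k≤m m≤p′ ⟩
    f m       <⟨ ≤∧≢⇒< (f-mono₁ (n≤1+n m) (≤-trans m<l l≤p′)) fm≢fm+1 ⟩
    f (suc m) ≤⟨ f-mono₁ m<l l≤p′ ⟩
    f l       ∎
    where open ≤-Reasoning
          m≤p′ : m ≤ p′
          m≤p′ = ≤-trans (<⇒≤ m<l) l≤p′
  ... | inj₂ p<k  | inj₂ fm≢fm+1 = begin-strict
    f k       ≤⟨ f-mono₂ p<k k≤m m≤N ⟩
    f m       <⟨ ≤∧≢⇒< (f-mono₂ p<m (n≤1+n m) (≤-trans m<l l≤N)) fm≢fm+1 ⟩
    f (suc m) ≤⟨ f-mono₂ (≤-trans p<m (n≤1+n m)) m<l l≤N ⟩
    f l       ∎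
    where open ≤-Reasoning
          m≤N : m ≤ N
          m≤N = ≤-trans (<⇒≤ m<l) l≤N
          p<m : suc p′ ≤ m
          p<m = ≤-trans p<k k≤m

  T : ℕ
  T = suc (rank N)

  σ₀ : Fin (suc N) → Fin T
  σ₀ i = fromℕ< (s≤s (rank-mono (toℕ≤pred[n] i)))

  toℕ-σ₀ : ∀ i → toℕ (σ₀ i) ≡ rank (toℕ i)
  toℕ-σ₀ i = toℕ-fromℕ< (s≤s (rank-mono (toℕ≤pred[n] i)))

  σ₀-mono : Nondecreasing σ₀
  σ₀-mono i j i≤j = subst₂ _≤_ (sym (toℕ-σ₀ i)) (sym (toℕ-σ₀ j)) (rank-mono i≤j)

  σ₀-surj : Surj σ₀
  σ₀-surj y with rank-surj N (≤-pred (toℕ<n y))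
  ... | k , k≤N , rk≡y = fromℕ< (s≤s k≤N) ,
        toℕ-injective (trans (toℕ-σ₀ (fromℕ< (s≤s k≤N))) (trans (cong rank (toℕ-fromℕ< (s≤s k≤N))) rk≡y))

  section : Fin T → Fin (suc N)
  section y = proj₁ (σ₀-surj y)

  rank-section : ∀ y → rank (toℕ (section y)) ≡ toℕ y
  rank-section y = trans (sym (toℕ-σ₀ (section y))) (cong toℕ (proj₂ (σ₀-surj y)))

  δ₀ : Fin T → Fin s
  δ₀ = φ ∘ section

  factor₀ : ∀ k → φ k ≡ δ₀ (σ₀ k)
  factor₀ k = toℕ-injective (begin
    toℕ (φ k)                 ≡⟨ extend-toℕ φ k ⟨
    f (toℕ k)                 ≡⟨ rank-fibres-constant f f-flat {toℕ k} {toℕ (section (σ₀ k))}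
                                   (trans (sym (toℕ-σ₀ k)) (sym (rank-section (σ₀ k)))) ⟩
    f (toℕ (section (σ₀ k)))  ≡⟨ extend-toℕ φ (section (σ₀ k)) ⟩
    toℕ (δ₀ (σ₀ k))           ∎)
    where open ≡-Reasoning

  δ₀-surj : Surj δ₀
  δ₀-surj z with φ-surj z
  ... | k , φk≡z = σ₀ k , trans (sym (factor₀ k)) φk≡z

  rank-p′<rank-1+p′ : rank p′ < rank (suc p′)
  rank-p′<rank-1+p′ = ≤-reflexive (sym (rank-ascent (inj₁ refl)))

  a₀ : ℕ
  a₀ = suc (rank p′)

  a₀<T : a₀ < T
  a₀<T = s≤s (≤-trans rank-p′<rank-1+p′ (rank-mono p′<N))

  δ₀-< : ∀ x y → toℕ x < toℕ y → toℕ (section y) ≤ p′ ⊎ suc p′ ≤ toℕ (section x) →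
         toℕ (δ₀ x) < toℕ (δ₀ y)
  δ₀-< x y x<y side = subst₂ _<_ (extend-toℕ φ (section x)) (extend-toℕ φ (section y))
    (rank-<⇒f-< (subst₂ _<_ (sym (rank-section x)) (sym (rank-section y)) x<y) side
                (toℕ≤pred[n] (section y)))

  δ₀-strict : StrictOnBlocks a₀ δ₀
  δ₀-strict = first , second
    where
    first : ∀ x y → toℕ x < toℕ y → toℕ y < a₀ → toℕ (δ₀ x) < toℕ (δ₀ y)
    first x y x<y y<a₀ = δ₀-< x y x<y (inj₁ (ascent-separates (inj₁ refl)
      (subst (_≤ rank p′) (sym (rank-section y)) (≤-pred y<a₀))))
    second : ∀ x y → a₀ ≤ toℕ x → toℕ x < toℕ y → toℕ (δ₀ x) < toℕ (δ₀ y)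
    second x y a₀≤x x<y = δ₀-< x y x<y (inj₂ (≰⇒> λ x≤p′ →
      <⇒≱ a₀≤x (subst (_≤ rank p′) (rank-section x) (rank-mono x≤p′))))

  δ₀-quasiShuffle : IsQuasiShuffle a₀ (T ∸ a₀) (T ∸ s) δ₀
  δ₀-quasiShuffle = s≤s z≤n , m<n⇒0<n∸m a₀<T , sym (m+[n∸m]≡n (<⇒≤ a₀<T)) ,
    trans (m+[n∸m]≡n (surj⇒≤ δ₀-surj)) (sym (m+[n∸m]≡n (<⇒≤ a₀<T))) , δ₀-surj , δ₀-strict

  toℕ-σ₀-at-p′ : ∀ i → suc (toℕ i) ≡ suc p′ → toℕ (σ₀ i) ≡ rank p′
  toℕ-σ₀-at-p′ i i≡p′ = trans (toℕ-σ₀ i) (cong rank (suc-injective i≡p′))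

  decomposition : Decomposition (suc p′) (suc q′) s φ
  decomposition = record
    { t      = T
    ; σ      = σ₀
    ; δ      = δ₀
    ; 2≤t    = s≤s (≤-trans (s≤s z≤n) (≤-pred a₀<T))
    ; t≤p+q  = s≤s (rank-≤ N)
    ; σ-mono = σ₀-mono
    ; σ-surj = σ₀-surj
    ; σ-jump = λ i j i≡p′ j≡p → subst₂ _<_ (sym (toℕ-σ₀-at-p′ i i≡p′))
                 (sym (trans (toℕ-σ₀ j) (cong rank j≡p))) rank-p′<rank-1+p′
    ; δ-qs   = λ i i≡p′ → subst (λ v → IsQuasiShuffle (suc v) (T ∸ suc v) (T ∸ s) δ₀)
                 (sym (toℕ-σ₀-at-p′ i i≡p′)) δ₀-quasiShuffle
    ; factor = factor₀
    }

  module _ (E : Decomposition (suc p′) (suc q′) s φ) where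

    δσ≡f : ∀ i → toℕ (δ E (σ E i)) ≡ f (toℕ i)
    δσ≡f i = trans (cong toℕ (sym (factor E i))) (sym (extend-toℕ φ i))

    i₀ j₀ : Fin (suc N)
    i₀ = fromℕ< (s≤s (<⇒≤ p′<N))
    j₀ = fromℕ< (s≤s p′<N)

    i₀≡p′ : toℕ i₀ ≡ p′
    i₀≡p′ = toℕ-fromℕ< (s≤s (<⇒≤ p′<N))

    j₀≡1+p′ : toℕ j₀ ≡ suc p′
    j₀≡1+p′ = toℕ-fromℕ< (s≤s p′<N)

    δ-strict : StrictOnBlocks (suc (toℕ (σ E i₀))) (δ E)
    δ-strict = quasiShuffle-strict (δ-qs E i₀ (cong suc i₀≡p′))

    σ-up : ∀ i j → toℕ j ≡ suc (toℕ i) → Ascent (toℕ i) → toℕ (σ E j) ≡ suc (toℕ (σ E i))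
    σ-up i j j≡1+i a = ≤-antisym (nondecreasing-surj-step (σ-mono E) (σ-surj E) i j j≡1+i) (jumps a)
      where
      jumps : Ascent (toℕ i) → toℕ (σ E i) < toℕ (σ E j)
      jumps (inj₁ i≡p′) = σ-jump E i j (cong suc i≡p′) (trans j≡1+i (cong suc i≡p′))
      jumps (inj₂ fi≢fj) = ≤∧≢⇒< (σ-mono E i j (subst (toℕ i ≤_) (sym j≡1+i) (n≤1+n (toℕ i))))
        λ σi≡σj → fi≢fj (begin
          f (toℕ i)          ≡⟨ δσ≡f i ⟨
          toℕ (δ E (σ E i))  ≡⟨ cong (toℕ ∘ δ E) (toℕ-injective σi≡σj) ⟩
          toℕ (δ E (σ E j))  ≡⟨ δσ≡f j ⟩
          f (toℕ j)          ≡⟨ cong f j≡1+i ⟩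
          f (suc (toℕ i))    ∎)
        where open ≡-Reasoning

    σ-flat : ∀ i j → toℕ j ≡ suc (toℕ i) → ¬ Ascent (toℕ i) → toℕ (σ E j) ≡ toℕ (σ E i)
    σ-flat i j j≡1+i ¬a = ≤-antisym (≮⇒≥ no-jump) (σ-mono E i j i≤j)
      where
      i≤j : toℕ i ≤ toℕ j
      i≤j = subst (toℕ i ≤_) (sym j≡1+i) (n≤1+n (toℕ i))
      δ-< : toℕ (σ E i) < toℕ (σ E j) → toℕ (δ E (σ E i)) < toℕ (δ E (σ E j))
      δ-< σi<σj with <-cmp (toℕ i) p′
      ... | tri< i<p′ _ _ = proj₁ δ-strict (σ E i) (σ E j) σi<σj
              (s≤s (σ-mono E j i₀ (subst₂ _≤_ (sym j≡1+i) (sym i₀≡p′) i<p′)))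
      ... | tri≈ _ i≡p′ _ = contradiction (inj₁ i≡p′) ¬a
      ... | tri> _ _ p′<i = proj₂ δ-strict (σ E i) (σ E j)
              (≤-trans (σ-jump E i₀ j₀ (cong suc i₀≡p′) j₀≡1+p′)
                       (σ-mono E j₀ i (subst (_≤ toℕ i) (sym j₀≡1+p′) p′<i)))
              σi<σj
      no-jump : ¬ toℕ (σ E i) < toℕ (σ E j)
      no-jump σi<σj = <-irrefl (f-flat (toℕ i) ¬a)
        (subst₂ _<_ (δσ≡f i) (trans (δσ≡f j) (cong f j≡1+i)) (δ-< σi<σj))

    σ≡rank : ∀ i → toℕ (σ E i) ≡ rank (toℕ i)
    σ≡rank = rank-unique (σ E) (nondecreasing-surj-zero (σ-mono E) (σ-surj E)) σ-up σ-flat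

    T≡t : T ≡ t E
    T≡t = trans (cong suc (trans (cong rank (sym (toℕ-fromℕ N))) (sym (σ≡rank (fromℕ N)))))
                (nondecreasing-surj-last (σ-mono E) (σ-surj E))

    decomposition-unique : SameDecomposition decomposition E
    decomposition-unique = T≡t , (λ k → trans (toℕ-σ₀ k) (sym (σ≡rank k))) , δ-agree
      where
      δ-agree : ∀ (x : Fin T) (y : Fin (t E)) → toℕ x ≡ toℕ y → toℕ (δ₀ x) ≡ toℕ (δ E y)
      δ-agree x y x≡y = cong toℕ (begin
        δ₀ x                ≡⟨ cong δ₀ (proj₂ (σ₀-surj x)) ⟨
        δ₀ (σ₀ k)           ≡⟨ factor₀ k ⟨
        φ k                 ≡⟨ factor E k ⟩
        δ E (σ E k)         ≡⟨ cong (δ E) (toℕ-injective (trans (σ≡rank k) (trans (rank-section x) x≡y))) ⟩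
        δ E y               ∎)
        where open ≡-Reasoning
              k = section x

lemma4p1 : (p q s r : ℕ) → 1 ≤ p → 1 ≤ q → (φ : Fin (p + q) → Fin s) →
           IsWeakQuasiShuffle p q r φ →
           Σ (Decomposition p q s φ) (λ D → (E : Decomposition p q s φ) → SameDecomposition D E)
lemma4p1 (suc p′) (suc q′) s r (s≤s z≤n) (s≤s z≤n) φ (_ , φ-surj , φ-weak) =
  decomposition , decomposition-unique
  where open Decompose p′ q′ φ φ-surj φ-weak
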